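{- For $i=1,2$, let $G_i$ be a finite, simple, connected graph of order $n_i$ with metric dimension $k_i$, exactly one metric basis, and maximum degree $\Delta(G_i)=n_i-1$. Then there exists a finite, simple, connected graph $G$ of order $n_1+n_2-1$ with metric dimension $k_1+k_2$, exactly one metric basis, and maximum degree $\Delta(G)=n_1+n_2-2$.
   Context: For vertices $u,v$ of a connected graph $G$, $d(u,v)$ is the distance between them. For an ordered set $W=\{w_1,\dots,w_k\}\subseteq V(G)$ and $v\in V(G)$, $r(v|W)=(d(v,w_1),\dots,d(v,w_k))$. $W$ is a resolving set if distinct vertices have distinct representations $r(\cdot|W)$. A resolving set of minimum cardinality is a metric basis; its cardinality is the metric dimension $\beta(G)$. -}

module Defs where

open import Data.Nat using (ℕ; zero; suc; _≤_)
open import Data.Bool using (Bool; true; false)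
open import Data.Fin using (Fin)
open import Data.Fin.Subset using (Subset; _∈_; ∣_∣)
open import Data.Vec using (tabulate)
open import Data.Product using (Σ; ∃; _×_)
open import Relation.Binary.PropositionalEquality using (_≡_)

record Graph (n : ℕ) : Set where
  field
    Adj    : Fin n → Fin n → Bool
    sym    : ∀ u v → Adj u v ≡ Adj v u
    irrefl : ∀ v → Adj v v ≡ false
open Graph public

data Walk {n : ℕ} (G : Graph n) : Fin n → Fin n → ℕ → Set where
  here : ∀ {u} → Walk G u u zero
  step : ∀ {u w v m} → Adj G u w ≡ true → Walk G w v m → Walk G u v (suc m)

Connected : ∀ {n} → Graph n → Set
Connected G = ∀ u v → ∃ λ m → Walk G u v m

Dist : ∀ {n} → Graph n → Fin n → Fin n → ℕ → Set
Dist G u v m = Walk G u v m × (∀ m' → Walk G u v m' → m ≤ m')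

Resolving : ∀ {n} → Graph n → Subset n → Set
Resolving G W = ∀ u v →
  (∀ w → w ∈ W → ∀ m m' → Dist G u w m → Dist G v w m' → m ≡ m') → u ≡ v

IsMetricBasis : ∀ {n} → Graph n → Subset n → Set
IsMetricBasis G W = Resolving G W × (∀ W' → Resolving G W' → ∣ W ∣ ≤ ∣ W' ∣)

MetricDim : ∀ {n} → Graph n → ℕ → Set
MetricDim G k = Σ _ λ W → IsMetricBasis G W × ∣ W ∣ ≡ k

UniqueMetricBasis : ∀ {n} → Graph n → Set
UniqueMetricBasis G = Σ _ λ W → IsMetricBasis G W × (∀ W' → IsMetricBasis G W' → W' ≡ W)

degree : ∀ {n} → Graph n → Fin n → ℕ
degree G v = ∣ tabulate (Adj G v) ∣

MaxDegree : ∀ {n} → Graph n → ℕ → Set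
MaxDegree G d = (∃ λ v → degree G v ≡ d) × (∀ v → degree G v ≤ d)

module Submission where

-- A vertex of degree n - 1 is universal, so all graphs involved have diameter at most two and
-- their distances are read off from adjacency. A universal vertex c lies in no unique metric
-- basis B: otherwise B - c, or else B - c + x for the one vertex x that B - c fails to separate
-- from c, would be a smaller or a second basis. Glue G₁ and G₂ along their universal vertices and
-- join the remaining vertices of G₁ to those of G₂. A resolving set W of the result restricts to
-- resolving sets W₁ of G₁ and W₂ of G₂ with |W₁| + |W₂| = |W| + [centre ∈ W]; this forces
-- (B₁ - c₁) ∪ B₂ to be the unique metric basis, of size k₁ + k₂.

open import Defs hiding (sym)
open import Data.Nat using (ℕ; zero; suc; _+_; _∸_; _≤_; _<_; z≤n; s≤s)
open import Data.Nat.Properties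
  using (≤-refl; ≤-reflexive; ≤-trans; ≤-antisym; ≤∧≢⇒<; <-irrefl; ≤-pred; +-comm; +-assoc; +-suc;
         +-identityʳ; +-monoˡ-≤; +-monoʳ-≤; +-mono-≤; +-cancelʳ-≤; suc-injective; m≤m+n; +-commutativeSemigroup; 1+n≢0; module ≤-Reasoning)
open import Data.Bool using (Bool; true; false; if_then_else_)
open import Data.Fin using (Fin; _≟_; punchIn; punchOut; _↑ˡ_; _↑ʳ_; splitAt)
open import Data.Fin.Properties
  using (punchInᵢ≢i; punchIn-punchOut; ↑ˡ-injective; ↑ʳ-injective; splitAt-↑ˡ; splitAt-↑ʳ; splitAt⁻¹-↑ˡ; splitAt⁻¹-↑ʳ)
open import Data.Fin.Subset using (Subset; ∣_∣; ⊤)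
open import Data.Fin.Subset.Properties using (∣p∣≤n; ∣⊤∣≡n)
open import Data.Vec using ([]; _∷_; lookup; tabulate; insertAt; removeAt; _[_]≔_; _++_)
  renaming (splitAt to splitAtᵛ)
open import Data.Vec.Properties
  using (lookup∘update; lookup∘update′; lookup∘tabulate; tabulate∘lookup; tabulate-cong; lookup-replicate;
         []=⇒lookup; lookup⇒[]=; lookup-++ˡ; lookup-++ʳ; insertAt-lookup; insertAt-punchIn;
         insertAt-removeAt; removeAt-insertAt)
open import Data.Product using (Σ; ∃; _×_; _,_; proj₁; proj₂)
open import Data.Sum using (_⊎_; inj₁; inj₂)
open import Data.Empty using (⊥-elim)
open import Function using (_∘_; mk⇔)
open import Algebra.Properties.CommutativeSemigroup +-commutativeSemigroup using (interchange)
open import Relation.Nullary using (¬_; yes; no; does)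
open import Relation.Nullary.Decidable using (dec-true; does-⇔)
open import Relation.Binary.PropositionalEquality
  using (_≡_; _≢_; refl; sym; trans; cong; cong₂; subst; ≢-sym; module ≡-Reasoning)

private
  variable
    m n : ℕ

true≢false : true ≢ false
true≢false ()

bit : Bool → ℕ
bit b = if b then 1 else 0

∣∷∣ : ∀ b (p : Subset n) → ∣ b ∷ p ∣ ≡ bit b + ∣ p ∣
∣∷∣ true  p = refl
∣∷∣ false p = refl

∣++∣ : (p : Subset m) (q : Subset n) → ∣ p ++ q ∣ ≡ ∣ p ∣ + ∣ q ∣
∣++∣ []          q = refl
∣++∣ (true ∷ p)  q = cong suc (∣++∣ p q)
∣++∣ (false ∷ p) q = ∣++∣ p q

∣insertAt∣ : ∀ (p : Subset n) i b → ∣ insertAt p i b ∣ ≡ bit b + ∣ p ∣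
∣insertAt∣ p           Fin.zero    b = ∣∷∣ b p
∣insertAt∣ (true ∷ p)  (Fin.suc i) b = trans (cong suc (∣insertAt∣ p i b)) (sym (+-suc (bit b) ∣ p ∣))
∣insertAt∣ (false ∷ p) (Fin.suc i) b = ∣insertAt∣ p i b

∣[]≔∣ : ∀ (p : Subset n) i {a} b → lookup p i ≡ a → ∣ p [ i ]≔ b ∣ + bit a ≡ ∣ p ∣ + bit b
∣[]≔∣ (x ∷ p) Fin.zero b refl = begin
  ∣ b ∷ p ∣ + bit x     ≡⟨ cong (_+ bit x) (∣∷∣ b p) ⟩
  (bit b + ∣ p ∣) + bit x ≡⟨ +-assoc (bit b) ∣ p ∣ (bit x) ⟩
  bit b + (∣ p ∣ + bit x) ≡⟨ +-comm (bit b) _ ⟩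
  (∣ p ∣ + bit x) + bit b ≡⟨ cong (_+ bit b) (trans (+-comm ∣ p ∣ (bit x)) (sym (∣∷∣ x p))) ⟩
  ∣ x ∷ p ∣ + bit b     ∎
  where open ≡-Reasoning
∣[]≔∣ (true  ∷ p) (Fin.suc i) b eq = cong suc (∣[]≔∣ p i b eq)
∣[]≔∣ (false ∷ p) (Fin.suc i) b eq = ∣[]≔∣ p i b eq

lookup≡false⇒∣p∣<n : ∀ (p : Subset n) i → lookup p i ≡ false → ∣ p ∣ < n
lookup≡false⇒∣p∣<n {n} p i pᵢ≡false = begin
  suc ∣ p ∣                ≡⟨ +-comm 1 ∣ p ∣ ⟩
  ∣ p ∣ + 1                ≡⟨ ∣[]≔∣ p i true pᵢ≡false ⟨
  ∣ p [ i ]≔ true ∣ + 0    ≡⟨ +-identityʳ _ ⟩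
  ∣ p [ i ]≔ true ∣        ≤⟨ ∣p∣≤n (p [ i ]≔ true) ⟩
  n                        ∎
  where open ≤-Reasoning

+-cancel-part : ∀ {x y z t a b} → x + y ≡ z + t → z ≤ a + b → b + t ≤ y → x ≤ a
+-cancel-part {x} {y} {z} {t} {a} {b} sum z≤a+b b+t≤y = +-cancelʳ-≤ (b + t) x a (begin
  x + (b + t)    ≤⟨ +-monoʳ-≤ x b+t≤y ⟩
  x + y          ≡⟨ sum ⟩
  z + t          ≤⟨ +-monoˡ-≤ t z≤a+b ⟩
  (a + b) + t    ≡⟨ +-assoc a b t ⟩
  a + (b + t)    ∎)
  where open ≤-Reasoning

-- Universal vertices and distances

Universal : Graph n → Fin n → Set
Universal G c = ∀ v → c ≢ v → Adj G c v ≡ true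

degree<n : (G : Graph n) (v : Fin n) → degree G v < n
degree<n G v = lookup≡false⇒∣p∣<n (tabulate (Adj G v)) v (trans (lookup∘tabulate (Adj G v) v) (irrefl G v))

universal⇒maxDegree : (G : Graph n) {c : Fin n} → Universal G c → MaxDegree G (n ∸ 1)
universal⇒maxDegree {suc n} G {c} univ = (c , degree-c) , λ v → ≤-pred (degree<n G v)
  where
  neighbourhood : tabulate (Adj G c) ≡ ⊤ [ c ]≔ false
  neighbourhood = trans (tabulate-cong adjacency) (tabulate∘lookup _)
    where
    adjacency : ∀ v → Adj G c v ≡ lookup (⊤ [ c ]≔ false) v
    adjacency v with c ≟ v
    ... | yes refl = trans (irrefl G c) (sym (lookup∘update c ⊤ false))
    ... | no c≢v   = trans (univ v c≢v) (sym (trans (lookup∘update′ (≢-sym c≢v) ⊤ false) (lookup-replicate v true)))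
  degree-c : degree G c ≡ n
  degree-c = suc-injective (begin
    suc (degree G c)            ≡⟨ +-comm 1 _ ⟩
    degree G c + 1              ≡⟨ cong (λ p → ∣ p ∣ + 1) neighbourhood ⟩
    ∣ ⊤ [ c ]≔ false ∣ + 1      ≡⟨ ∣[]≔∣ ⊤ c false (lookup-replicate c true) ⟩
    ∣ ⊤ {suc n} ∣ + 0           ≡⟨ trans (+-identityʳ _) (∣⊤∣≡n (suc n)) ⟩
    suc n                       ∎)
    where open ≡-Reasoning

maxDegree⇒universal : (G : Graph n) → MaxDegree G (n ∸ 1) → Σ (Fin n) (Universal G)
maxDegree⇒universal {suc n} G ((c , degree-c) , _) = c , universal
  where
  universal : Universal G c
  universal v c≢v with Adj G c v in cv
  ... | true  = refl
  ... | false = ⊥-elim (<-irrefl refl (≤-pred (begin-strict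
    suc (degree G c)                          ≡⟨ +-comm 1 _ ⟩
    degree G c + 1                            ≡⟨ ∣[]≔∣ (tabulate (Adj G c)) v true (trans (lookup∘tabulate (Adj G c) v) cv) ⟨
    ∣ tabulate (Adj G c) [ v ]≔ true ∣ + 0    ≡⟨ +-identityʳ _ ⟩
    ∣ tabulate (Adj G c) [ v ]≔ true ∣        <⟨ lookup≡false⇒∣p∣<n (tabulate (Adj G c) [ v ]≔ true) c c-entry ⟩
    suc n                                     ≡⟨ cong suc degree-c ⟨
    suc (degree G c)                          ∎)))
    where
    open ≤-Reasoning
    c-entry : lookup (tabulate (Adj G c) [ v ]≔ true) c ≡ false
    c-entry = trans (lookup∘update′ c≢v (tabulate (Adj G c)) true) (trans (lookup∘tabulate (Adj G c) c) (irrefl G c))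

-- The distance in any graph of diameter at most two.
dist₂ : Graph n → Fin n → Fin n → ℕ
dist₂ G u v = if does (u ≟ v) then 0 else if Adj G u v then 1 else 2

dist₂-refl : (G : Graph n) (u : Fin n) → dist₂ G u u ≡ 0
dist₂-refl G u rewrite dec-true (u ≟ u) refl = refl

adjacent⇒dist₂≡1 : (G : Graph n) {u v : Fin n} → Adj G u v ≡ true → dist₂ G u v ≡ 1
adjacent⇒dist₂≡1 G {u} {v} uv with u ≟ v
... | yes refl with () ← trans (sym uv) (irrefl G u)
... | no _ rewrite uv = refl

dist₂≤2 : (G : Graph n) (u v : Fin n) → dist₂ G u v ≤ 2
dist₂≤2 G u v with does (u ≟ v) | Adj G u v
... | true  | _     = z≤n
... | false | true  = s≤s z≤n
... | false | false = ≤-refl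

dist₂≤walk : (G : Graph n) {u v : Fin n} {k : ℕ} → Walk G u v k → dist₂ G u v ≤ k
dist₂≤walk G {u} here                  = ≤-reflexive (dist₂-refl G u)
dist₂≤walk G (step uw here)            = ≤-reflexive (adjacent⇒dist₂≡1 G uw)
dist₂≤walk G {u} {v} (step _ (step _ _)) = ≤-trans (dist₂≤2 G u v) (s≤s (s≤s z≤n))

Realizes : Graph n → (Fin n → Fin n → ℕ) → Set
Realizes G d = ∀ u v → Dist G u v (d u v)

Dist-functional : (G : Graph n) {u v : Fin n} {k k′ : ℕ} → Dist G u v k → Dist G u v k′ → k ≡ k′
Dist-functional G (walk , minimal) (walk′ , minimal′) = ≤-antisym (minimal _ walk′) (minimal′ _ walk)

module _ (G : Graph n) {c : Fin n} (univ : Universal G c) where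

  adjacent-to-universal : ∀ {u} → u ≢ c → Adj G u c ≡ true
  adjacent-to-universal {u} u≢c = trans (Graph.sym G u c) (univ u (≢-sym u≢c))

  dist₂-to-universal : ∀ {u} → u ≢ c → dist₂ G u c ≡ 1
  dist₂-to-universal u≢c = adjacent⇒dist₂≡1 G (adjacent-to-universal u≢c)

  dist₂-from-universal : ∀ {v} → c ≢ v → dist₂ G c v ≡ 1
  dist₂-from-universal {v} c≢v = adjacent⇒dist₂≡1 G (univ v c≢v)

  walk-dist₂ : ∀ u v → Walk G u v (dist₂ G u v)
  walk-dist₂ u v with u ≟ v
  ... | yes refl = here
  ... | no u≢v with Adj G u v in uv
  ...   | true  = step uv here
  ...   | false = step (adjacent-to-universal u≢c) (step (univ v c≢v) here)
    where
    u≢c : u ≢ c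
    u≢c refl with () ← trans (sym (univ v u≢v)) uv
    c≢v : c ≢ v
    c≢v refl with () ← trans (sym (adjacent-to-universal u≢v)) uv

  universal⇒realizes-dist₂ : Realizes G (dist₂ G)
  universal⇒realizes-dist₂ u v = walk-dist₂ u v , λ _ → dist₂≤walk G

  universal⇒connected : Connected G
  universal⇒connected u v = dist₂ G u v , walk-dist₂ u v

-- Resolving sets

Indistinguishable : (Fin n → Fin n → ℕ) → Subset n → Fin n → Fin n → Set
Indistinguishable d W u v = ∀ w → lookup W w ≡ true → d u w ≡ d v w

Resolves : (Fin n → Fin n → ℕ) → Subset n → Set
Resolves d W = ∀ u v → Indistinguishable d W u v → u ≡ v

IsBasis : (Fin n → Fin n → ℕ) → Subset n → Set
IsBasis d W = Resolves d W × (∀ W′ → Resolves d W′ → ∣ W ∣ ≤ ∣ W′ ∣)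

IsUniqueBasis : (Fin n → Fin n → ℕ) → Subset n → Set
IsUniqueBasis d B = IsBasis d B × (∀ W → IsBasis d W → W ≡ B)

module _ {d : Fin n → Fin n → ℕ} {W : Subset n} where

  resolves-around : (c : Fin n) →
                    (∀ {p q} → p ≢ c → q ≢ c → Indistinguishable d W p q → p ≡ q) →
                    (∀ {x} → x ≢ c → ¬ Indistinguishable d W x c) →
                    Resolves d W
  resolves-around c off-c no-twin u v h with u ≟ c | v ≟ c
  ... | yes refl | yes refl = refl
  ... | yes refl | no v≢c   = ⊥-elim (no-twin v≢c λ w w∈W → sym (h w w∈W))
  ... | no u≢c   | yes refl = ⊥-elim (no-twin u≢c h)
  ... | no u≢c   | no v≢c   = off-c u≢c v≢c h

module _ (G : Graph n) {d : Fin n → Fin n → ℕ} (realizes : Realizes G d) where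

  resolving⇒resolves : ∀ {W} → Resolving G W → Resolves d W
  resolving⇒resolves res u v h = res u v λ w w∈W _ _ du dv →
    trans (Dist-functional G du (realizes u w))
          (trans (h w ([]=⇒lookup w∈W)) (Dist-functional G (realizes v w) dv))

  resolves⇒resolving : ∀ {W} → Resolves d W → Resolving G W
  resolves⇒resolving {W} res u v h =
    res u v λ w w∈W → h w (lookup⇒[]= w W w∈W) _ _ (realizes u w) (realizes v w)

  isMetricBasis⇒isBasis : ∀ {W} → IsMetricBasis G W → IsBasis d W
  isMetricBasis⇒isBasis (res , min) = resolving⇒resolves res , λ W′ res′ → min W′ (resolves⇒resolving res′)

  isBasis⇒isMetricBasis : ∀ {W} → IsBasis d W → IsMetricBasis G W
  isBasis⇒isMetricBasis (res , min) = resolves⇒resolving res , λ W′ res′ → min W′ (resolving⇒resolves res′)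

  uniqueMetricBasis⇒isUniqueBasis : (unique : UniqueMetricBasis G) → IsUniqueBasis d (proj₁ unique)
  uniqueMetricBasis⇒isUniqueBasis (B , basis , only) =
    isMetricBasis⇒isBasis basis , λ W basis′ → only W (isBasis⇒isMetricBasis basis′)

  isUniqueBasis⇒uniqueMetricBasis : ∀ {B} → IsUniqueBasis d B → UniqueMetricBasis G
  isUniqueBasis⇒uniqueMetricBasis {B} (basis , only) =
    B , isBasis⇒isMetricBasis basis , λ W basis′ → only W (isMetricBasis⇒isBasis basis′)

  metricDim-of-uniqueBasis : ∀ {B k} → IsUniqueBasis d B → MetricDim G k → ∣ B ∣ ≡ k
  metricDim-of-uniqueBasis (_ , only) (W , basis , ∣W∣≡k) =
    trans (cong ∣_∣ (sym (only W (isMetricBasis⇒isBasis basis)))) ∣W∣≡k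

module _ {d : Fin n → Fin n → ℕ} {B : Subset n} (unique : IsUniqueBasis d B) where

  resolves-≤⇒≡ : ∀ {S} → Resolves d S → ∣ S ∣ ≤ ∣ B ∣ → S ≡ B
  resolves-≤⇒≡ S-res S≤B = proj₂ unique _ (S-res , λ W W-res → ≤-trans S≤B (proj₂ (proj₁ unique) W W-res))

  uniqueBasis-bound : ∀ {c S} → lookup B c ≡ false → Resolves d S → ∣ B ∣ + bit (lookup S c) ≤ ∣ S ∣
  uniqueBasis-bound {c} {S} c∉B S-res with lookup S c in c∈S
  ... | false = ≤-trans (≤-reflexive (+-identityʳ _)) (proj₂ (proj₁ unique) S S-res)
  ... | true  = subst (_≤ ∣ S ∣) (+-comm 1 ∣ B ∣) (≤∧≢⇒< (proj₂ (proj₁ unique) S S-res) B≢S)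
    where
    B≢S : ∣ B ∣ ≢ ∣ S ∣
    B≢S eq with () ← trans (sym c∈S) (trans (cong (λ X → lookup X c) (resolves-≤⇒≡ {S} S-res (≤-reflexive (sym eq)))) c∉B)

module _ (G : Graph n) {c : Fin n} (univ : Universal G c)
         {B : Subset n} (unique : IsUniqueBasis (dist₂ G) B) where

  private
    B-res : Resolves (dist₂ G) B
    B-res = proj₁ (proj₁ unique)

  B-c : Subset n
  B-c = B [ c ]≔ false

  B∖c⊆B-c : ∀ w → w ≢ c → lookup B w ≡ true → lookup B-c w ≡ true
  B∖c⊆B-c w w≢c w∈B = trans (lookup∘update′ w≢c B false) w∈B

  separates-off-universal : ∀ S → (∀ w → w ≢ c → lookup B w ≡ true → lookup S w ≡ true) →
                            ∀ {p q} → p ≢ c → q ≢ c → Indistinguishable (dist₂ G) S p q → p ≡ q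
  separates-off-universal S B∖c⊆S {p} {q} p≢c q≢c h = B-res p q λ w w∈B → by-cases w w∈B
    where
    by-cases : ∀ w → lookup B w ≡ true → dist₂ G p w ≡ dist₂ G q w
    by-cases w w∈B with w ≟ c
    ... | yes refl = trans (dist₂-to-universal G univ p≢c) (sym (dist₂-to-universal G univ q≢c))
    ... | no w≢c   = h w (B∖c⊆S w w≢c w∈B)

  -- Otherwise B - c + x would be a basis other than B.
  universal-no-twin : lookup B c ≡ true → ∀ {x} → x ≢ c → ¬ Indistinguishable (dist₂ G) B-c x c
  universal-no-twin c∈B {x} x≢c x≈c = true≢false (trans (sym c∈B) (trans (cong (λ X → lookup X c) (sym W≡B)) c∉W))
    where
    x∉B-c : lookup B-c x ≡ false
    x∉B-c with lookup B-c x in x∈B-c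
    ... | false = refl
    ... | true with () ← trans (sym (dist₂-refl G x)) (trans (x≈c x x∈B-c) (dist₂-from-universal G univ (≢-sym x≢c)))

    W : Subset n
    W = B-c [ x ]≔ true

    B-c⊆W : ∀ w → lookup B-c w ≡ true → lookup W w ≡ true
    B-c⊆W w w∈B-c with w ≟ x
    ... | yes refl = lookup∘update x B-c true
    ... | no w≢x   = trans (lookup∘update′ w≢x B-c true) w∈B-c

    no-twin : ∀ {q} → q ≢ c → ¬ Indistinguishable (dist₂ G) W q c
    no-twin {q} q≢c q≈c = 1+n≢0 (begin
      1            ≡⟨ dist₂-from-universal G univ (≢-sym x≢c) ⟨
      dist₂ G c x  ≡⟨ q≈c x (lookup∘update x B-c true) ⟨
      dist₂ G q x  ≡⟨ cong (λ y → dist₂ G y x) q≡x ⟩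
      dist₂ G x x  ≡⟨ dist₂-refl G x ⟩
      0            ∎)
      where
      open ≡-Reasoning
      q≡x : q ≡ x
      q≡x = separates-off-universal B-c B∖c⊆B-c q≢c x≢c λ w w∈B-c → trans (q≈c w (B-c⊆W w w∈B-c)) (sym (x≈c w w∈B-c))

    W≡B : W ≡ B
    W≡B = resolves-≤⇒≡ unique
      (resolves-around {W = W} c (separates-off-universal W λ w w≢c w∈B → B-c⊆W w (B∖c⊆B-c w w≢c w∈B)) no-twin)
      (≤-reflexive (begin
        ∣ W ∣          ≡⟨ +-identityʳ _ ⟨
        ∣ W ∣ + 0      ≡⟨ ∣[]≔∣ B-c x true x∉B-c ⟩
        ∣ B-c ∣ + 1    ≡⟨ trans (∣[]≔∣ B c false c∈B) (+-identityʳ ∣ B ∣) ⟩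
        ∣ B ∣          ∎))
      where open ≡-Reasoning

    c∉W : lookup W c ≡ false
    c∉W = trans (lookup∘update′ (≢-sym x≢c) B-c true) (lookup∘update c B false)

  universal∉uniqueBasis : lookup B c ≡ false
  universal∉uniqueBasis with lookup B c in c∈B
  ... | false = refl
  ... | true  = ⊥-elim (<-irrefl refl (begin-strict
    ∣ B-c ∣        <⟨ ≤-reflexive (trans (+-comm 1 ∣ B-c ∣) (trans (∣[]≔∣ B c false c∈B) (+-identityʳ ∣ B ∣))) ⟩
    ∣ B ∣          ≤⟨ proj₂ (proj₁ unique) B-c B-c-resolves ⟩
    ∣ B-c ∣        ∎))
    where
    open ≤-Reasoning
    B-c-resolves : Resolves (dist₂ G) B-c
    B-c-resolves = resolves-around {W = B-c} c (separates-off-universal B-c B∖c⊆B-c) (universal-no-twin c∈B)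

-- Embeddings, vertex deletion and joins

record Embedding (G : Graph m) (H : Graph n) : Set where
  field
    map       : Fin m → Fin n
    injective : ∀ {x y} → map x ≡ map y → x ≡ y
    adjacency : ∀ x y → Adj H (map x) (map y) ≡ Adj G x y

pullback : (Fin m → Fin n) → Subset n → Subset m
pullback f W = tabulate (lookup W ∘ f)

module _ {G : Graph m} {H : Graph n} (f : Embedding G H) where
  open Embedding f

  dist₂-embedding : ∀ x y → dist₂ H (map x) (map y) ≡ dist₂ G x y
  dist₂-embedding x y = cong₂ (λ same adjacent → if same then 0 else if adjacent then 1 else 2)
    (does-⇔ (mk⇔ injective (cong map)) (map x ≟ map y) (x ≟ y)) (adjacency x y)

  Equidistant : Fin n → Set
  Equidistant w = ∀ x y → dist₂ H (map x) w ≡ dist₂ H (map y) w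

  pullback-resolves : (∀ w → (∃ λ z → map z ≡ w) ⊎ Equidistant w) →
                      ∀ {W} → Resolves (dist₂ H) W → Resolves (dist₂ G) (pullback map W)
  pullback-resolves covered {W} W-res x y h = injective (W-res (map x) (map y) h′)
    where
    h′ : Indistinguishable (dist₂ H) W (map x) (map y)
    h′ w w∈W with covered w
    ... | inj₂ equidistant = equidistant x y
    ... | inj₁ (z , refl)  = begin
      dist₂ H (map x) (map z)  ≡⟨ dist₂-embedding x z ⟩
      dist₂ G x z              ≡⟨ h z (trans (lookup∘tabulate (lookup W ∘ map) z) w∈W) ⟩
      dist₂ G y z              ≡⟨ dist₂-embedding y z ⟨
      dist₂ H (map y) (map z)  ∎
      where open ≡-Reasoning

  pullback-separates : ∀ {W} → Resolves (dist₂ G) (pullback map W) →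
                       ∀ {x y u v} → map x ≡ u → map y ≡ v → Indistinguishable (dist₂ H) W u v → u ≡ v
  pullback-separates {W} res {x} {y} refl refl h = cong map (res x y λ z z∈ →
    trans (sym (dist₂-embedding x z))
          (trans (h (map z) (trans (sym (lookup∘tabulate (lookup W ∘ map) z)) z∈)) (dist₂-embedding y z)))

data PunchInView {n} (c : Fin (suc n)) : Fin (suc n) → Set where
  pivot   : PunchInView c c
  punched : (a : Fin n) → PunchInView c (punchIn c a)

punchInView : (c x : Fin (suc n)) → PunchInView c x
punchInView c x with c ≟ x
... | yes refl = pivot
... | no c≢x   = subst (PunchInView c) (punchIn-punchOut c≢x) (punched (punchOut c≢x))

data SplitView (m n : ℕ) : Fin (m + n) → Set where
  left  : (a : Fin m) → SplitView m n (a ↑ˡ n)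
  right : (b : Fin n) → SplitView m n (m ↑ʳ b)

splitView : ∀ m {n} (i : Fin (m + n)) → SplitView m n i
splitView m i with splitAt m i in eq
... | inj₁ a = subst (SplitView m _) (splitAt⁻¹-↑ˡ eq) (left a)
... | inj₂ b = subst (SplitView m _) (splitAt⁻¹-↑ʳ eq) (right b)

↑ˡ≢↑ʳ : ∀ (a : Fin m) (b : Fin n) → a ↑ˡ n ≢ m ↑ʳ b
↑ˡ≢↑ʳ {m} {n} a b eq with () ← trans (sym (splitAt-↑ˡ m a n)) (trans (cong (splitAt m) eq) (splitAt-↑ʳ m n b))

removeVertex : Graph (suc n) → Fin (suc n) → Graph n
removeVertex G c = record
  { Adj    = λ a b → Adj G (punchIn c a) (punchIn c b)
  ; sym    = λ a b → Graph.sym G (punchIn c a) (punchIn c b)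
  ; irrefl = λ a → irrefl G (punchIn c a)
  }

module _ (H : Graph m) (K : Graph n) where

  private
    adj : Fin m ⊎ Fin n → Fin m ⊎ Fin n → Bool
    adj (inj₁ a) (inj₁ b) = Adj H a b
    adj (inj₂ a) (inj₂ b) = Adj K a b
    adj (inj₁ _) (inj₂ _) = true
    adj (inj₂ _) (inj₁ _) = true

    adj-sym : ∀ s t → adj s t ≡ adj t s
    adj-sym (inj₁ a) (inj₁ b) = Graph.sym H a b
    adj-sym (inj₂ a) (inj₂ b) = Graph.sym K a b
    adj-sym (inj₁ _) (inj₂ _) = refl
    adj-sym (inj₂ _) (inj₁ _) = refl

    adj-irrefl : ∀ s → adj s s ≡ false
    adj-irrefl (inj₁ a) = irrefl H a
    adj-irrefl (inj₂ b) = irrefl K b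

  join : Graph (m + n)
  join = record
    { Adj    = λ i j → adj (splitAt m i) (splitAt m j)
    ; sym    = λ i j → adj-sym (splitAt m i) (splitAt m j)
    ; irrefl = λ i → adj-irrefl (splitAt m i)
    }

  join-left : ∀ a b → Adj join (a ↑ˡ n) (b ↑ˡ n) ≡ Adj H a b
  join-left a b rewrite splitAt-↑ˡ m a n | splitAt-↑ˡ m b n = refl

  join-right : ∀ a b → Adj join (m ↑ʳ a) (m ↑ʳ b) ≡ Adj K a b
  join-right a b rewrite splitAt-↑ʳ m n a | splitAt-↑ʳ m n b = refl

  join-across : ∀ a b → Adj join (a ↑ˡ n) (m ↑ʳ b) ≡ true
  join-across a b rewrite splitAt-↑ˡ m a n | splitAt-↑ʳ m n b = refl

  join-across′ : ∀ a b → Adj join (m ↑ʳ b) (a ↑ˡ n) ≡ true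
  join-across′ a b = trans (Graph.sym join _ _) (join-across a b)

module Amalgamation
  {m₁ m₂ : ℕ}
  (G₁ : Graph (suc m₁)) {c₁ : Fin (suc m₁)} (univ₁ : Universal G₁ c₁)
  {B₁ : Subset (suc m₁)} (unique₁ : IsUniqueBasis (dist₂ G₁) B₁)
  (G₂ : Graph (suc m₂)) {c₂ : Fin (suc m₂)} (univ₂ : Universal G₂ c₂)
  {B₂ : Subset (suc m₂)} (unique₂ : IsUniqueBasis (dist₂ G₂) B₂)
  where

  H₁ : Graph m₁
  H₁ = removeVertex G₁ c₁

  -- G₁ and G₂ glued along c₁ = c₂ = centre, with every other vertex of G₁ adjacent to every
  -- other vertex of G₂.
  G : Graph (m₁ + suc m₂)
  G = join H₁ G₂

  centre : Fin (m₁ + suc m₂)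
  centre = m₁ ↑ʳ c₂

  centre-universal : Universal G centre
  centre-universal v centre≢v with splitView m₁ v
  ... | left a  = join-across′ H₁ G₂ a c₂
  ... | right y = trans (join-right H₁ G₂ c₂ y) (univ₂ y (centre≢v ∘ cong (m₁ ↑ʳ_)))

  c₁∉B₁ : lookup B₁ c₁ ≡ false
  c₁∉B₁ = universal∉uniqueBasis G₁ univ₁ unique₁

  c₂∉B₂ : lookup B₂ c₂ ≡ false
  c₂∉B₂ = universal∉uniqueBasis G₂ univ₂ unique₂

  e₁ : Fin (suc m₁) → Fin (m₁ + suc m₂)
  e₁ = lookup (insertAt (tabulate (_↑ˡ suc m₂)) c₁ centre)

  e₁-pivot : e₁ c₁ ≡ centre
  e₁-pivot = insertAt-lookup (tabulate (_↑ˡ suc m₂)) c₁ centre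

  e₁-punchIn : ∀ a → e₁ (punchIn c₁ a) ≡ a ↑ˡ suc m₂
  e₁-punchIn a = trans (insertAt-punchIn (tabulate (_↑ˡ suc m₂)) c₁ centre a) (lookup∘tabulate (_↑ˡ suc m₂) a)

  e₁-injective : ∀ {x y} → e₁ x ≡ e₁ y → x ≡ y
  e₁-injective {x} {y} eq with punchInView c₁ x | punchInView c₁ y
  ... | pivot     | pivot     = refl
  ... | pivot     | punched b = ⊥-elim (↑ˡ≢↑ʳ b c₂ (trans (sym (e₁-punchIn b)) (trans (sym eq) e₁-pivot)))
  ... | punched a | pivot     = ⊥-elim (↑ˡ≢↑ʳ a c₂ (trans (sym (e₁-punchIn a)) (trans eq e₁-pivot)))
  ... | punched a | punched b =
    cong (punchIn c₁) (↑ˡ-injective (suc m₂) a b (trans (sym (e₁-punchIn a)) (trans eq (e₁-punchIn b))))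

  e₁-adjacency : ∀ x y → Adj G (e₁ x) (e₁ y) ≡ Adj G₁ x y
  e₁-adjacency x y with punchInView c₁ x | punchInView c₁ y
  ... | pivot     | pivot     rewrite e₁-pivot = trans (irrefl G centre) (sym (irrefl G₁ c₁))
  ... | pivot     | punched b rewrite e₁-pivot | e₁-punchIn b =
    trans (join-across′ H₁ G₂ b c₂) (sym (univ₁ (punchIn c₁ b) (≢-sym (punchInᵢ≢i c₁ b))))
  ... | punched a | pivot     rewrite e₁-pivot | e₁-punchIn a =
    trans (join-across H₁ G₂ a c₂) (sym (adjacent-to-universal G₁ univ₁ (punchInᵢ≢i c₁ a)))
  ... | punched a | punched b rewrite e₁-punchIn a | e₁-punchIn b = join-left H₁ G₂ a b

  inl : Embedding G₁ G
  inl = record { map = e₁ ; injective = e₁-injective ; adjacency = e₁-adjacency }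

  inr : Embedding G₂ G
  inr = record { map = m₁ ↑ʳ_ ; injective = ↑ʳ-injective m₁ _ _ ; adjacency = join-right H₁ G₂ }

  e₁-adjacent-right : ∀ x b → Adj G (e₁ x) (m₁ ↑ʳ punchIn c₂ b) ≡ true
  e₁-adjacent-right x b with punchInView c₁ x
  ... | pivot     rewrite e₁-pivot     = trans (join-right H₁ G₂ c₂ _) (univ₂ _ (≢-sym (punchInᵢ≢i c₂ b)))
  ... | punched a rewrite e₁-punchIn a = join-across H₁ G₂ a _

  inl-covers : ∀ w → (∃ λ z → e₁ z ≡ w) ⊎ Equidistant inl w
  inl-covers w with splitView m₁ w
  ... | left a = inj₁ (punchIn c₁ a , e₁-punchIn a)
  ... | right y with punchInView c₂ y
  ...   | pivot     = inj₁ (c₁ , e₁-pivot)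
  ...   | punched b = inj₂ λ x x′ → trans (adjacent⇒dist₂≡1 G (e₁-adjacent-right x b))
                                           (sym (adjacent⇒dist₂≡1 G (e₁-adjacent-right x′ b)))

  inr-covers : ∀ w → (∃ λ z → m₁ ↑ʳ z ≡ w) ⊎ Equidistant inr w
  inr-covers w with splitView m₁ w
  ... | right y = inj₁ (y , refl)
  ... | left a  = inj₂ λ y y′ → trans (adjacent⇒dist₂≡1 G (join-across′ H₁ G₂ a y))
                                      (sym (adjacent⇒dist₂≡1 G (join-across′ H₁ G₂ a y′)))

  R₁ : Subset (m₁ + suc m₂) → Subset (suc m₁)
  R₁ = pullback e₁

  R₂ : Subset (m₁ + suc m₂) → Subset (suc m₂)
  R₂ = pullback (m₁ ↑ʳ_)

  R₁-resolves : ∀ W → Resolves (dist₂ G) W → Resolves (dist₂ G₁) (R₁ W)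
  R₁-resolves W = pullback-resolves inl inl-covers {W}

  R₂-resolves : ∀ W → Resolves (dist₂ G) W → Resolves (dist₂ G₂) (R₂ W)
  R₂-resolves W = pullback-resolves inr inr-covers {W}

  R₁-++ : ∀ xs ys → R₁ (xs ++ ys) ≡ insertAt xs c₁ (lookup ys c₂)
  R₁-++ xs ys = trans (tabulate-cong entry) (tabulate∘lookup _)
    where
    entry : ∀ x → lookup (xs ++ ys) (e₁ x) ≡ lookup (insertAt xs c₁ (lookup ys c₂)) x
    entry x with punchInView c₁ x
    ... | pivot     rewrite e₁-pivot     = trans (lookup-++ʳ xs ys c₂) (sym (insertAt-lookup xs c₁ _))
    ... | punched a rewrite e₁-punchIn a = trans (lookup-++ˡ xs ys a) (sym (insertAt-punchIn xs c₁ _ a))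

  R₂-++ : ∀ xs ys → R₂ (xs ++ ys) ≡ ys
  R₂-++ xs ys = trans (tabulate-cong (lookup-++ʳ xs ys)) (tabulate∘lookup ys)

  R₁-pivot : ∀ W → lookup (R₁ W) c₁ ≡ lookup W centre
  R₁-pivot W = trans (lookup∘tabulate (lookup W ∘ e₁) c₁) (cong (lookup W) e₁-pivot)

  R₂-pivot : ∀ W → lookup (R₂ W) c₂ ≡ lookup W centre
  R₂-pivot W = lookup∘tabulate (lookup W ∘ (m₁ ↑ʳ_)) c₂

  ∣R₁∣+∣R₂∣ : ∀ W → ∣ R₁ W ∣ + ∣ R₂ W ∣ ≡ ∣ W ∣ + bit (lookup W centre)
  ∣R₁∣+∣R₂∣ W with splitAtᵛ m₁ W
  ... | xs , ys , refl = begin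
    ∣ R₁ (xs ++ ys) ∣ + ∣ R₂ (xs ++ ys) ∣           ≡⟨ cong₂ _+_ (cong ∣_∣ (R₁-++ xs ys)) (cong ∣_∣ (R₂-++ xs ys)) ⟩
    ∣ insertAt xs c₁ (lookup ys c₂) ∣ + ∣ ys ∣      ≡⟨ cong (_+ ∣ ys ∣) (∣insertAt∣ xs c₁ _) ⟩
    (bit (lookup ys c₂) + ∣ xs ∣) + ∣ ys ∣          ≡⟨ +-assoc (bit (lookup ys c₂)) ∣ xs ∣ ∣ ys ∣ ⟩
    bit (lookup ys c₂) + (∣ xs ∣ + ∣ ys ∣)          ≡⟨ +-comm (bit (lookup ys c₂)) _ ⟩
    (∣ xs ∣ + ∣ ys ∣) + bit (lookup ys c₂)          ≡⟨ cong₂ _+_ (∣++∣ xs ys) (cong bit (lookup-++ʳ xs ys c₂)) ⟨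
    ∣ xs ++ ys ∣ + bit (lookup (xs ++ ys) centre)   ∎
    where open ≡-Reasoning

  reassemble : ∀ W → removeAt (R₁ W) c₁ ++ R₂ W ≡ W
  reassemble W with splitAtᵛ m₁ W
  ... | xs , ys , refl =
    cong₂ _++_ (trans (cong (λ X → removeAt X c₁) (R₁-++ xs ys)) (removeAt-insertAt xs c₁ _)) (R₂-++ xs ys)

  B : Subset (m₁ + suc m₂)
  B = removeAt B₁ c₁ ++ B₂

  centre∉B : lookup B centre ≡ false
  centre∉B = trans (lookup-++ʳ (removeAt B₁ c₁) B₂ c₂) c₂∉B₂

  R₁B≡B₁ : R₁ B ≡ B₁
  R₁B≡B₁ = trans (R₁-++ (removeAt B₁ c₁) B₂)
    (trans (cong (insertAt (removeAt B₁ c₁) c₁) (trans c₂∉B₂ (sym c₁∉B₁))) (insertAt-removeAt B₁ c₁))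

  R₂B≡B₂ : R₂ B ≡ B₂
  R₂B≡B₂ = R₂-++ (removeAt B₁ c₁) B₂

  R₁B-resolves : Resolves (dist₂ G₁) (R₁ B)
  R₁B-resolves = subst (Resolves (dist₂ G₁)) (sym R₁B≡B₁) (proj₁ (proj₁ unique₁))

  R₂B-resolves : Resolves (dist₂ G₂) (R₂ B)
  R₂B-resolves = subst (Resolves (dist₂ G₂)) (sym R₂B≡B₂) (proj₁ (proj₁ unique₂))

  ∣B∣≡∣B₁∣+∣B₂∣ : ∣ B ∣ ≡ ∣ B₁ ∣ + ∣ B₂ ∣
  ∣B∣≡∣B₁∣+∣B₂∣ = begin
    ∣ B ∣                          ≡⟨ +-identityʳ _ ⟨
    ∣ B ∣ + bit false              ≡⟨ cong (λ b → ∣ B ∣ + bit b) centre∉B ⟨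
    ∣ B ∣ + bit (lookup B centre)  ≡⟨ ∣R₁∣+∣R₂∣ B ⟨
    ∣ R₁ B ∣ + ∣ R₂ B ∣            ≡⟨ cong₂ (λ X Y → ∣ X ∣ + ∣ Y ∣) R₁B≡B₁ R₂B≡B₂ ⟩
    ∣ B₁ ∣ + ∣ B₂ ∣                ∎
    where open ≡-Reasoning

  dist₂-centre-B : ∀ {w} → lookup B w ≡ true → dist₂ G centre w ≡ 1
  dist₂-centre-B {w} w∈B = dist₂-from-universal G centre-universal centre≢w
    where
    centre≢w : centre ≢ w
    centre≢w refl = true≢false (trans (sym w∈B) centre∉B)

  -- A left vertex indistinguishable from a right one would be indistinguishable from the centre,
  -- i.e. from the image of c₁.
  left-no-twin : ∀ a y → ¬ Indistinguishable (dist₂ G) B (a ↑ˡ suc m₂) (m₁ ↑ʳ y)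
  left-no-twin a y h = ↑ˡ≢↑ʳ a c₂ (pullback-separates inl {B} R₁B-resolves (e₁-punchIn a) e₁-pivot h′)
    where
    left-to-B : ∀ w → lookup B w ≡ true → dist₂ G (a ↑ˡ suc m₂) w ≡ 1
    left-to-B w w∈B with splitView m₁ w
    ... | left a′  = trans (h _ w∈B) (adjacent⇒dist₂≡1 G (join-across′ H₁ G₂ a′ y))
    ... | right y′ = adjacent⇒dist₂≡1 G (join-across H₁ G₂ a y′)
    h′ : Indistinguishable (dist₂ G) B (a ↑ˡ suc m₂) centre
    h′ w w∈B = trans (left-to-B w w∈B) (sym (dist₂-centre-B w∈B))

  B-resolves : Resolves (dist₂ G) B
  B-resolves u v h with splitView m₁ u | splitView m₁ v
  ... | left a  | left b  = pullback-separates inl {B} R₁B-resolves (e₁-punchIn a) (e₁-punchIn b) h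
  ... | right y | right z = pullback-separates inr {B} R₂B-resolves refl refl h
  ... | left a  | right y = ⊥-elim (left-no-twin a y h)
  ... | right y | left a  = ⊥-elim (left-no-twin a y λ w w∈B → sym (h w w∈B))

  R₁-bound : ∀ W → Resolves (dist₂ G) W → ∣ B₁ ∣ + bit (lookup W centre) ≤ ∣ R₁ W ∣
  R₁-bound W W-res = subst (λ b → ∣ B₁ ∣ + bit b ≤ ∣ R₁ W ∣) (R₁-pivot W)
    (uniqueBasis-bound unique₁ {c₁} {R₁ W} c₁∉B₁ (R₁-resolves W W-res))

  R₂-bound : ∀ W → Resolves (dist₂ G) W → ∣ B₂ ∣ + bit (lookup W centre) ≤ ∣ R₂ W ∣
  R₂-bound W W-res = subst (λ b → ∣ B₂ ∣ + bit b ≤ ∣ R₂ W ∣) (R₂-pivot W)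
    (uniqueBasis-bound unique₂ {c₂} {R₂ W} c₂∉B₂ (R₂-resolves W W-res))

  B-bound : ∀ W → Resolves (dist₂ G) W → ∣ B ∣ + bit (lookup W centre) ≤ ∣ W ∣
  B-bound W W-res = +-cancelʳ-≤ t (∣ B ∣ + t) ∣ W ∣ (begin
    (∣ B ∣ + t) + t                  ≡⟨ cong (λ b → (b + t) + t) ∣B∣≡∣B₁∣+∣B₂∣ ⟩
    ((∣ B₁ ∣ + ∣ B₂ ∣) + t) + t      ≡⟨ +-assoc (∣ B₁ ∣ + ∣ B₂ ∣) t t ⟩
    (∣ B₁ ∣ + ∣ B₂ ∣) + (t + t)      ≡⟨ interchange ∣ B₁ ∣ ∣ B₂ ∣ t t ⟩
    (∣ B₁ ∣ + t) + (∣ B₂ ∣ + t)      ≤⟨ +-mono-≤ (R₁-bound W W-res) (R₂-bound W W-res) ⟩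
    ∣ R₁ W ∣ + ∣ R₂ W ∣              ≡⟨ ∣R₁∣+∣R₂∣ W ⟩
    ∣ W ∣ + t                        ∎)
    where
    open ≤-Reasoning
    t : ℕ
    t = bit (lookup W centre)

  B-only : ∀ W → IsBasis (dist₂ G) W → W ≡ B
  B-only W (W-res , W-min) = begin
    W                            ≡⟨ reassemble W ⟨
    removeAt (R₁ W) c₁ ++ R₂ W   ≡⟨ cong₂ (λ X Y → removeAt X c₁ ++ Y) R₁W≡B₁ R₂W≡B₂ ⟩
    B                            ∎
    where
    open ≡-Reasoning
    ∣W∣≤∣B₁∣+∣B₂∣ : ∣ W ∣ ≤ ∣ B₁ ∣ + ∣ B₂ ∣
    ∣W∣≤∣B₁∣+∣B₂∣ = subst (∣ W ∣ ≤_) ∣B∣≡∣B₁∣+∣B₂∣ (W-min B B-resolves)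
    R₁W≡B₁ : R₁ W ≡ B₁
    R₁W≡B₁ = resolves-≤⇒≡ unique₁ {R₁ W} (R₁-resolves W W-res)
      (+-cancel-part (∣R₁∣+∣R₂∣ W) ∣W∣≤∣B₁∣+∣B₂∣ (R₂-bound W W-res))
    R₂W≡B₂ : R₂ W ≡ B₂
    R₂W≡B₂ = resolves-≤⇒≡ unique₂ {R₂ W} (R₂-resolves W W-res)
      (+-cancel-part (trans (+-comm ∣ R₂ W ∣ ∣ R₁ W ∣) (∣R₁∣+∣R₂∣ W))
                     (subst (∣ W ∣ ≤_) (+-comm ∣ B₁ ∣ ∣ B₂ ∣) ∣W∣≤∣B₁∣+∣B₂∣) (R₁-bound W W-res))

  B-isUniqueBasis : IsUniqueBasis (dist₂ G) B
  B-isUniqueBasis = (B-resolves , λ W W-res → ≤-trans (m≤m+n ∣ B ∣ _) (B-bound W W-res)) , B-only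

theorem7 : (n₁ n₂ k₁ k₂ : ℕ) (G₁ : Graph n₁) (G₂ : Graph n₂) →
    Connected G₁ → MetricDim G₁ k₁ → UniqueMetricBasis G₁ → MaxDegree G₁ (n₁ ∸ 1) →
    Connected G₂ → MetricDim G₂ k₂ → UniqueMetricBasis G₂ → MaxDegree G₂ (n₂ ∸ 1) →
    Σ (Graph (n₁ + n₂ ∸ 1)) λ G →
    Connected G × MetricDim G (k₁ + k₂) × UniqueMetricBasis G × MaxDegree G (n₁ + n₂ ∸ 2)
theorem7 zero _ _ _ _ _ _ _ _ ((() , _) , _) _ _ _ _
theorem7 (suc m₁) zero _ _ _ _ _ _ _ _ _ _ _ ((() , _) , _)
theorem7 (suc m₁) (suc m₂) k₁ k₂ G₁ G₂ _ dim₁ unique₁ maxDegree₁ _ dim₂ unique₂ maxDegree₂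
  with maxDegree⇒universal G₁ maxDegree₁ | maxDegree⇒universal G₂ maxDegree₂
... | _ , univ₁ | _ , univ₂ =
  G , universal⇒connected G centre-universal
    , (B , isBasis⇒isMetricBasis G realizes (proj₁ B-isUniqueBasis) , dimension)
    , isUniqueBasis⇒uniqueMetricBasis G realizes B-isUniqueBasis
    , universal⇒maxDegree G centre-universal
  where
  realizes₁ : Realizes G₁ (dist₂ G₁)
  realizes₁ = universal⇒realizes-dist₂ G₁ univ₁
  realizes₂ : Realizes G₂ (dist₂ G₂)
  realizes₂ = universal⇒realizes-dist₂ G₂ univ₂
  basis₁ : IsUniqueBasis (dist₂ G₁) (proj₁ unique₁)
  basis₁ = uniqueMetricBasis⇒isUniqueBasis G₁ realizes₁ unique₁
  basis₂ : IsUniqueBasis (dist₂ G₂) (proj₁ unique₂)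
  basis₂ = uniqueMetricBasis⇒isUniqueBasis G₂ realizes₂ unique₂
  open Amalgamation G₁ univ₁ basis₁ G₂ univ₂ basis₂
  realizes : Realizes G (dist₂ G)
  realizes = universal⇒realizes-dist₂ G centre-universal
  dimension : ∣ B ∣ ≡ k₁ + k₂
  dimension = trans ∣B∣≡∣B₁∣+∣B₂∣
    (cong₂ _+_ (metricDim-of-uniqueBasis G₁ realizes₁ basis₁ dim₁) (metricDim-of-uniqueBasis G₂ realizes₂ basis₂ dim₂))
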